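{- For every $\delta>0$ (as below) and any two configurations $C_1,C_2$ of $k$ servers on the line, $D^{\min}_{C_1}(\mathcal{P}^\delta_{C_1}[i])\le 2k\cdot D^{\min}_{C_2}(\mathcal{P}^\delta_{C_2}[i])$ for every index $i$.
   Context: The line $[0,1]$ is discretized into equally spaced points at distance $\delta>0$, with $\delta$ chosen so that the points $i/(2k)$, $i=0,\dots,2k$, are among them. A configuration is a placement of $k$ servers on $k$ distinct points. For a point $p$, $D^{\min}_C(p)$ is the distance from $p$ to the nearest server of $C$. $\mathcal{P}^\delta_C$ is the sequence of all points ordered by nondecreasing $D^{\min}_C$ (ties broken arbitrarily), and $\mathcal{P}^\delta_C[i]$ its $i$-th element. -}

module Defs where

open import Data.Nat using (ℕ; zero; suc; _+_; _*_; _⊓_; ∣_-_∣; _≤_)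
open import Data.Fin using (Fin; toℕ) renaming (zero to fzero; suc to fsuc; _≤_ to _≤ᶠ_)
open import Function.Definitions using (Injective; Bijective)
open import Relation.Binary.PropositionalEquality using (_≡_)
open import Data.Product using (_×_)

-- With δ = 1/(2k·m) (m ≥ 1), the grid points of [0,1]
-- are j·δ for j = 0 … 2km, represented by Fin (suc (2km)).
-- Distances are measured in units of δ (multiplying both sides of the
-- inequality by the positive constant 1/δ does not change it).
gridSize : ℕ → ℕ → ℕ
gridSize k m = 2 * k * m

Point : ℕ → ℕ → Set
Point k m = Fin (suc (gridSize k m))

record Config (k m : ℕ) : Set where
  constructor config
  field
    pos      : Fin k → Point k m
    distinct : Injective _≡_ _≡_ pos
open Config public

-- minimum of a family indexed by Fin n (value for n = 0 is irrelevant; k ≥ 1 is assumed)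
minFin : (n : ℕ) → (Fin n → ℕ) → ℕ
minFin zero f = 0
minFin (suc zero) f = f fzero
minFin (suc (suc n)) f = f fzero ⊓ minFin (suc n) (λ i → f (fsuc i))

Dmin : {k m : ℕ} → Config k m → Point k m → ℕ
Dmin {k} C p = minFin k (λ s → ∣ toℕ p - toℕ (pos C s) ∣)

-- P is an ordering 𝒫^δ_C of all points by nondecreasing D^min_C
-- (a bijection from indices to points; any tie-breaking allowed).
IsSortedOrder : {k m : ℕ} → Config k m → (Point k m → Point k m) → Set
IsSortedOrder C P =
  Bijective _≡_ _≡_ P × (∀ i j → i ≤ᶠ j → Dmin C (P i) ≤ Dmin C (P j))

module Submission where

-- Fix a configuration C of K = k + 1 servers and an
-- ordering P of the grid points by nondecreasing D^min_C, and put
-- d(i) = D^min_C (P i).  Two counting estimates tie d(i) to the index i: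
--  (upper) the i + 1 points P 0, …, P i all lie within distance d(i) of
--          some server, and each server has at most 2·d(i) + 1 grid points
--          that close, hence i + 1 ≤ K · (2·d(i) + 1);
--  (lower) if r = d(i) > 0, then the r grid points of the segment from the
--          server nearest to P i towards P i (that server included),
--          together with the K - 1 other servers, are r + K - 1 distinct
--          points at distance < r from C, so they all precede P i and
--          r + K - 1 ≤ i.
-- The lower estimate for C₁ and the upper one for C₂ at the same index give
-- r + K ≤ K · (2·d + 1), i.e. r ≤ 2K · d.

open import Defs
open import Data.Nat using (ℕ; zero; suc; _+_; _*_; _∸_; _≤_; _<_; _⊔_; ∣_-_∣; z≤n; s≤s; s≤s⁻¹)
open import Data.Nat.Properties
open import Data.Nat.Tactic.RingSolver using (solve-∀)
open import Data.Fin using (Fin; toℕ; fromℕ<; inject≤; splitAt; join; punchIn; combine)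
  renaming (zero to fzero; suc to fsuc)
open import Data.Fin.Properties using (toℕ-injective; toℕ<n; toℕ-fromℕ<; toℕ-inject≤; inject≤-injective; injective⇒≤; join-splitAt; punchIn-injective; punchInᵢ≢i; combine-injective)
open import Data.Sum using (_⊎_; inj₁; inj₂)
open import Data.Product using (_×_; _,_; proj₁; proj₂; ∃)
open import Data.Empty using (⊥-elim)
open import Function.Definitions using (Injective)
open import Relation.Binary.PropositionalEquality
open import Relation.Nullary using (yes; no)

minFin-≤ : ∀ n (f : Fin n → ℕ) (s : Fin n) → minFin n f ≤ f s
minFin-≤ (suc zero)    f fzero    = ≤-refl
minFin-≤ (suc (suc n)) f fzero    = m⊓n≤m _ _
minFin-≤ (suc (suc n)) f (fsuc s) =
  ≤-trans (m⊓n≤n _ _) (minFin-≤ (suc n) (λ i → f (fsuc i)) s)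

minFin-attained : ∀ n (f : Fin (suc n) → ℕ) → ∃ λ s → minFin (suc n) f ≡ f s
minFin-attained zero    f = fzero , refl
minFin-attained (suc n) f
  with ⊓-sel (f fzero) (minFin (suc n) (λ i → f (fsuc i)))
     | minFin-attained n (λ i → f (fsuc i))
... | inj₁ first | _          = fzero , first
... | inj₂ rest  | s , rest-s = fsuc s , trans rest rest-s

injective-below⇒≤ : ∀ {n M} (f : Fin n → ℕ) → (∀ x → f x < M) →
  Injective _≡_ _≡_ f → n ≤ M
injective-below⇒≤ f below f-inj = injective⇒≤ {f = λ x → fromℕ< (below x)}
  (λ {x} {y} e → f-inj (trans (sym (toℕ-fromℕ< (below x)))
                              (trans (cong toℕ e) (toℕ-fromℕ< (below y)))))

splitAt-injective : ∀ m n → Injective _≡_ _≡_ (splitAt m {n})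
splitAt-injective m n {x} {y} e =
  trans (sym (join-splitAt m n x)) (trans (cong (join m n) e) (join-splitAt m n y))

record SegmentPoint (a b t : ℕ) : Set where
  field
    point      : ℕ
    from-start : ∣ point - a ∣ ≡ t
    to-end     : ∣ b - point ∣ ≡ ∣ b - a ∣ ∸ t
    bounded    : point ≤ a ⊔ b
open SegmentPoint

segment-point : ∀ a b t → t ≤ ∣ b - a ∣ → SegmentPoint a b t
segment-point a b t t≤ with ≤-total a b
... | inj₁ a≤b = record
  { point = a + t ; from-start = from-a ; to-end = to-b
  ; bounded = ≤-trans a+t≤b (m≤n⊔m a b) }
  where
  a+t≤b : a + t ≤ b
  a+t≤b = subst (_≤ b) (+-comm t a)
    (m≤o∸n⇒m+n≤o t a≤b (subst (t ≤_) (m≤n⇒∣n-m∣≡n∸m a≤b) t≤))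
  from-a : ∣ a + t - a ∣ ≡ t
  from-a = trans (∣-∣-comm (a + t) a) (∣m-m+n∣≡n a t)
  to-b : ∣ b - a + t ∣ ≡ ∣ b - a ∣ ∸ t
  to-b = begin
    ∣ b - a + t ∣  ≡⟨ m≤n⇒∣n-m∣≡n∸m a+t≤b ⟩
    b ∸ (a + t)    ≡⟨ ∸-+-assoc b a t ⟨
    b ∸ a ∸ t      ≡⟨ cong (_∸ t) (m≤n⇒∣n-m∣≡n∸m a≤b) ⟨
    ∣ b - a ∣ ∸ t  ∎
    where open ≡-Reasoning
... | inj₂ b≤a = record
  { point = a ∸ t ; from-start = from-a ; to-end = to-b
  ; bounded = ≤-trans (m∸n≤m a t) (m≤m⊔n a b) }
  where
  t≤a∸b : t ≤ a ∸ b
  t≤a∸b = subst (t ≤_) (m≤n⇒∣m-n∣≡n∸m b≤a) t≤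
  b≤a∸t : b ≤ a ∸ t
  b≤a∸t = m+n≤o⇒m≤o∸n b (subst (_≤ a) (+-comm t b) (m≤o∸n⇒m+n≤o t b≤a t≤a∸b))
  from-a : ∣ a ∸ t - a ∣ ≡ t
  from-a = trans (m≤n⇒∣m-n∣≡n∸m (m∸n≤m a t))
                 (m∸[m∸n]≡n (≤-trans t≤a∸b (m∸n≤m a b)))
  to-b : ∣ b - a ∸ t ∣ ≡ ∣ b - a ∣ ∸ t
  to-b = begin
    ∣ b - a ∸ t ∣  ≡⟨ m≤n⇒∣m-n∣≡n∸m b≤a∸t ⟩
    a ∸ t ∸ b      ≡⟨ ∸-+-assoc a t b ⟩
    a ∸ (t + b)    ≡⟨ cong (a ∸_) (+-comm t b) ⟩
    a ∸ (b + t)    ≡⟨ ∸-+-assoc a b t ⟨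
    a ∸ b ∸ t      ≡⟨ cong (_∸ t) (m≤n⇒∣m-n∣≡n∸m b≤a) ⟨
    ∣ b - a ∣ ∸ t  ∎
    where open ≡-Reasoning

-- The window of points q with ∣ q - a ∣ ≤ d is coded injectively by the
-- offset q + d ∸ a, which ranges over 0 … d + d.
window-offset-≤ : ∀ {q a d} → ∣ q - a ∣ ≤ d → q + d ∸ a ≤ d + d
window-offset-≤ {q} {a} {d} close = m≤n+o⇒m∸n≤o (q + d) a (begin
  q + d          ≤⟨ +-monoˡ-≤ d (≤-trans (m≤n+∣m-n∣ q a) (+-monoʳ-≤ a close)) ⟩
  a + d + d      ≡⟨ +-assoc a d d ⟩
  a + (d + d)    ∎)
  where open ≤-Reasoning

window-offset-injective : ∀ {q q′ a d} → ∣ q - a ∣ ≤ d → ∣ q′ - a ∣ ≤ d →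
  q + d ∸ a ≡ q′ + d ∸ a → q ≡ q′
window-offset-injective {q} {q′} {a} {d} close close′ e =
  +-cancelʳ-≡ d q q′ (∸-cancelʳ-≡ (a≤+d close) (a≤+d close′) e)
  where
  a≤+d : ∀ {p} → ∣ p - a ∣ ≤ d → a ≤ p + d
  a≤+d {p} c = ≤-trans (m≤n+∣n-m∣ a p) (+-monoʳ-≤ p c)

n≤n∸m⇒m≡0 : ∀ {n m} → 0 < n → n ≤ n ∸ m → m ≡ 0
n≤n∸m⇒m≡0         {m = zero}  _ _  = refl
n≤n∸m⇒m≡0 {suc n} {suc m}     _ le = ⊥-elim (<⇒≱ (s≤s (m∸n≤m n m)) le)

counts⇒bound : ∀ {k r i d} → r + k ≤ i → suc i ≤ suc k * suc (d + d) →
  r ≤ 2 * suc k * d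
counts⇒bound {k} {r} {i} {d} lower upper = +-cancelʳ-≤ (suc k) r (2 * suc k * d) (begin
  r + suc k              ≡⟨ +-suc r k ⟩
  suc (r + k)            ≤⟨ s≤s lower ⟩
  suc i                  ≤⟨ upper ⟩
  suc k * suc (d + d)    ≡⟨ expand k d ⟩
  2 * suc k * d + suc k  ∎)
  where
  open ≤-Reasoning
  expand : ∀ k d → suc k * suc (d + d) ≡ 2 * suc k * d + suc k
  expand = solve-∀

module OneConfiguration {k m : ℕ} (C : Config (suc k) m) where

  dist : Point (suc k) m → Fin (suc k) → ℕ
  dist q s = ∣ toℕ q - toℕ (pos C s) ∣

  Dmin-≤-dist : ∀ q s → Dmin C q ≤ dist q s
  Dmin-≤-dist q = minFin-≤ (suc k) (dist q)

  nearest : ∀ q → ∃ λ s → Dmin C q ≡ dist q s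
  nearest q = minFin-attained k (dist q)

  -- Upper estimate: at most (k + 1)(2d + 1) distinct points lie within
  -- distance d of C, coded by their nearest server and window offset.
  within-≤ : ∀ {n} d (g : Fin n → Point (suc k) m) → Injective _≡_ _≡_ g →
    (∀ x → Dmin C (g x) ≤ d) → n ≤ suc k * suc (d + d)
  within-≤ {n} d g g-inj near = injective⇒≤ {f = code} code-injective
    where
    server : Fin n → Fin (suc k)
    server x = proj₁ (nearest (g x))
    anchor : Fin n → ℕ
    anchor x = toℕ (pos C (server x))
    close : ∀ x → ∣ toℕ (g x) - anchor x ∣ ≤ d
    close x = subst (_≤ d) (proj₂ (nearest (g x))) (near x)
    offset-bound : ∀ x → toℕ (g x) + d ∸ anchor x < suc (d + d)
    offset-bound x = s≤s (window-offset-≤ {toℕ (g x)} {anchor x} (close x))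
    code : Fin n → Fin (suc k * suc (d + d))
    code x = combine (server x) (fromℕ< (offset-bound x))
    code-injective : Injective _≡_ _≡_ code
    code-injective {x} {y} e = g-inj (toℕ-injective
      (window-offset-injective (close x) close-y same-offset))
      where
      parts : server x ≡ server y × fromℕ< (offset-bound x) ≡ fromℕ< (offset-bound y)
      parts = combine-injective (server x) _ (server y) _ e
      same-anchor : anchor y ≡ anchor x
      same-anchor = cong (λ s → toℕ (pos C s)) (sym (proj₁ parts))
      close-y : ∣ toℕ (g y) - anchor x ∣ ≤ d
      close-y = subst (λ a → ∣ toℕ (g y) - a ∣ ≤ d) same-anchor (close y)
      same-offset : toℕ (g x) + d ∸ anchor x ≡ toℕ (g y) + d ∸ anchor x
      same-offset = begin
        toℕ (g x) + d ∸ anchor x            ≡⟨ toℕ-fromℕ< (offset-bound x) ⟨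
        toℕ (fromℕ< (offset-bound x))       ≡⟨ cong toℕ (proj₂ parts) ⟩
        toℕ (fromℕ< (offset-bound y))       ≡⟨ toℕ-fromℕ< (offset-bound y) ⟩
        toℕ (g y) + d ∸ anchor y            ≡⟨ cong (toℕ (g y) + d ∸_) same-anchor ⟩
        toℕ (g y) + d ∸ anchor x            ∎
        where open ≡-Reasoning

  -- Lower estimate: for a point q at distance r > 0 from C, the r points of
  -- the segment from q's nearest server s towards q (s included) and the k
  -- servers other than s form r + k distinct points at distance < r from C.
  module Closer (q : Point (suc k) m) (r>0 : 0 < Dmin C q) where
    private
      r : ℕ
      r = Dmin C q
      s : Fin (suc k)
      s = proj₁ (nearest q)
      anchor : ℕ
      anchor = toℕ (pos C s)

      segment : (t : Fin r) → SegmentPoint anchor (toℕ q) (toℕ t)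
      segment t = segment-point anchor (toℕ q) (toℕ t)
        (subst (toℕ t ≤_) (proj₂ (nearest q)) (<⇒≤ (toℕ<n t)))

      in-grid : ∀ t → point (segment t) < suc (gridSize (suc k) m)
      in-grid t = ≤-<-trans (bounded (segment t)) (⊔-lub (toℕ<n (pos C s)) (toℕ<n q))

      step : Fin r → Point (suc k) m
      step t = fromℕ< (in-grid t)

      step-from-server : ∀ t → ∣ toℕ (step t) - anchor ∣ ≡ toℕ t
      step-from-server t = trans (cong (∣_- anchor ∣) (toℕ-fromℕ< (in-grid t)))
                                 (from-start (segment t))

      step-to-q : ∀ t → ∣ toℕ q - toℕ (step t) ∣ ≡ ∣ toℕ q - anchor ∣ ∸ toℕ t
      step-to-q t = trans (cong (∣ toℕ q -_∣) (toℕ-fromℕ< (in-grid t)))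
                          (to-end (segment t))

      -- s is the only server on the segment: another one would be closer
      -- to q than its nearest server.
      server-on-segment : ∀ s′ t → pos C s′ ≡ step t → s′ ≡ s
      server-on-segment s′ t e = distinct C (toℕ-injective (trans (cong toℕ e)
        (∣m-n∣≡0⇒m≡n (trans (step-from-server t) t≡0))))
        where
        r≤r∸t : r ≤ r ∸ toℕ t
        r≤r∸t = begin
          r                                 ≤⟨ Dmin-≤-dist q s′ ⟩
          ∣ toℕ q - toℕ (pos C s′) ∣        ≡⟨ cong (λ p → ∣ toℕ q - toℕ p ∣) e ⟩
          ∣ toℕ q - toℕ (step t) ∣          ≡⟨ step-to-q t ⟩
          ∣ toℕ q - anchor ∣ ∸ toℕ t        ≡⟨ cong (_∸ toℕ t) (proj₂ (nearest q)) ⟨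
          r ∸ toℕ t                         ∎
          where open ≤-Reasoning
        t≡0 : toℕ t ≡ 0
        t≡0 = n≤n∸m⇒m≡0 r>0 r≤r∸t

      family : Fin r ⊎ Fin k → Point (suc k) m
      family (inj₁ t) = step t
      family (inj₂ j) = pos C (punchIn s j)

      family-injective : Injective _≡_ _≡_ family
      family-injective {inj₁ t} {inj₁ t′} e = cong inj₁ (toℕ-injective
        (trans (sym (step-from-server t))
               (trans (cong (λ p → ∣ toℕ p - anchor ∣) e) (step-from-server t′))))
      family-injective {inj₂ j} {inj₂ j′} e = cong inj₂ (punchIn-injective s j j′ (distinct C e))
      family-injective {inj₁ t} {inj₂ j} e = ⊥-elim (punchInᵢ≢i s j (server-on-segment _ t (sym e)))
      family-injective {inj₂ j} {inj₁ t} e = ⊥-elim (punchInᵢ≢i s j (server-on-segment _ t e))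

      family-closer : ∀ x → Dmin C (family x) < r
      family-closer (inj₁ t) = ≤-<-trans (Dmin-≤-dist (step t) s)
        (subst (_< r) (sym (step-from-server t)) (toℕ<n t))
      family-closer (inj₂ j) = ≤-<-trans (Dmin-≤-dist (pos C (punchIn s j)) (punchIn s j))
        (subst (_< r) (sym (∣n-n∣≡0 (toℕ (pos C (punchIn s j))))) r>0)

    closer : Fin (Dmin C q + k) → Point (suc k) m
    closer x = family (splitAt r x)

    closer-injective : Injective _≡_ _≡_ closer
    closer-injective e = splitAt-injective r k (family-injective e)

    closer-close : ∀ x → Dmin C (closer x) < Dmin C q
    closer-close x = family-closer (splitAt r x)

module SortedOrder {k m : ℕ} (C : Config k m) (P : Point k m → Point k m)
                   (sorted : IsSortedOrder C P) where

  private
    index : Point k m → Point k m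
    index q = proj₁ (proj₂ (proj₁ sorted) q)

    P-index : ∀ q → P (index q) ≡ q
    P-index q = proj₂ (proj₂ (proj₁ sorted) q) refl

    monotone : ∀ i j → toℕ i ≤ toℕ j → Dmin C (P i) ≤ Dmin C (P j)
    monotone = proj₂ sorted

  index-< : ∀ i q → Dmin C q < Dmin C (P i) → toℕ (index q) < toℕ i
  index-< i q closer with toℕ (index q) <? toℕ i
  ... | yes before = before
  ... | no  not-before = ⊥-elim (<⇒≱ closer
    (subst (λ p → Dmin C (P i) ≤ Dmin C p) (P-index q) (monotone i (index q) (≮⇒≥ not-before))))

  closer-≤ : ∀ {n} i (g : Fin n → Point k m) → Injective _≡_ _≡_ g →
    (∀ x → Dmin C (g x) < Dmin C (P i)) → n ≤ toℕ i
  closer-≤ i g g-inj closer = injective-below⇒≤ (λ x → toℕ (index (g x)))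
    (λ x → index-< i (g x) (closer x))
    (λ e → g-inj (trans (sym (P-index _)) (trans (cong P (toℕ-injective e)) (P-index _))))

  prefix : ∀ i → Fin (suc (toℕ i)) → Point k m
  prefix i j = P (inject≤ j (toℕ<n i))

  prefix-injective : ∀ i → Injective _≡_ _≡_ (prefix i)
  prefix-injective i e = inject≤-injective _ _ _ _ (proj₁ (proj₁ sorted) e)

  prefix-close : ∀ i j → Dmin C (prefix i j) ≤ Dmin C (P i)
  prefix-close i j = monotone (inject≤ j (toℕ<n i)) i
    (subst (_≤ toℕ i) (sym (toℕ-inject≤ j (toℕ<n i))) (s≤s⁻¹ (toℕ<n j)))

module Counts {k m : ℕ} (C : Config (suc k) m) (P : Point (suc k) m → Point (suc k) m)
              (sorted : IsSortedOrder C P) where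
  open OneConfiguration C
  open SortedOrder C P sorted

  lower-count : ∀ i → 0 < Dmin C (P i) → Dmin C (P i) + k ≤ toℕ i
  lower-count i r>0 = closer-≤ i closer closer-injective closer-close
    where open Closer (P i) r>0

  upper-count : ∀ i → suc (toℕ i) ≤ suc k * suc (Dmin C (P i) + Dmin C (P i))
  upper-count i = within-≤ (Dmin C (P i)) (prefix i) (prefix-injective i) (prefix-close i)

lemma7 : (k m : ℕ) → 1 ≤ k → 1 ≤ m →
    (C₁ C₂ : Config k m) →
    (P₁ P₂ : Point k m → Point k m) →
    IsSortedOrder C₁ P₁ → IsSortedOrder C₂ P₂ →
    ∀ i → Dmin C₁ (P₁ i) ≤ (2 * k) * Dmin C₂ (P₂ i)
lemma7 (suc k) m _ _ C₁ C₂ P₁ P₂ sorted₁ sorted₂ i with 0 <? Dmin C₁ (P₁ i)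
... | no  r≯0 = ≤-trans (≮⇒≥ r≯0) z≤n
... | yes r>0 = counts⇒bound
  (Counts.lower-count C₁ P₁ sorted₁ i r>0)
  (Counts.upper-count C₂ P₂ sorted₂ i)
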